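{- Let $G$ and $H$ be connected simple graphs on at least two vertices with $\chi''_a(G)\leq\Delta(G)+t$ for some integer $t\geq 2$ and $\chi''(H)\leq \Delta(H)+t'$ for some integer $1\leq t'\leq t$. If $\Delta(G)\geq\Delta(H)$, then $\chi''_a(G\circ H)\leq \Delta(G\circ H)+t$.
   Context: All graphs are finite and simple; $\Delta(\cdot)$ denotes maximum degree and $[k]=\{1,\ldots,k\}$. A proper total $k$-coloring of $G=(V,E)$ is a map $f:V\cup E\to[k]$ such that adjacent vertices get different colors, adjacent edges get different colors, and each edge gets a color different from the colors of its endvertices; $\chi''(G)$ is the least such $k$. The color set of $v$ is $C_f(v)=\{f(v)\}\cup\{f(vu): vu\in E\}$. An adjacent vertex distinguishing (avd) total $k$-coloring is a proper total $k$-coloring with $C_f(u)\neq C_f(v)$ for every edge $uv$; $\chi''_a(G)$ is the least such $k$. The corona $G\circ H$ is obtained from one copy of $G$ and $|V(G)|$ disjoint copies of $H$, one for each vertex $v$ of $G$, by joining each vertex $v$ of $G$ to every vertex of its copy of $H$. -}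

module Defs where

open import Data.Nat using (ℕ; zero; suc; _+_; _*_; _≤_; _⊔_)
open import Data.Fin using (Fin; zero; suc; combine; remQuot; _≟_)
open import Data.Bool using (Bool; true; false; _∧_)
open import Data.List using (List; length; filter; map; foldr)
open import Data.List.Base using (allFin)
open import Data.Product using (Σ; ∃; _×_; _,_)
open import Relation.Nullary using (¬_; does)
open import Relation.Binary.PropositionalEquality using (_≡_; _≢_)
open import Function.Bundles using (_⇔_)

record Graph : Set where
  field
    n   : ℕ
    adj : Fin n → Fin n → Bool

open Graph public

IsSimple : Graph → Set
IsSimple G = (∀ u v → adj G u v ≡ adj G v u) × (∀ v → adj G v v ≡ false)

data Reachable (G : Graph) : Fin (n G) → Fin (n G) → Set where
  here : ∀ {v} → Reachable G v v
  step : ∀ {u w v} → adj G u w ≡ true → Reachable G w v → Reachable G u v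

Connected : Graph → Set
Connected G = ∀ u v → Reachable G u v

deg : (G : Graph) → Fin (n G) → ℕ
deg G v = length (filter (λ u → adj G v u ≡? true) (allFin (n G)))
  where
  _≡?_ : (a b : Bool) → _
  _≡?_ = Data.Bool._≟_
    where import Data.Bool

Δ : Graph → ℕ
Δ G = foldr _⊔_ 0 (map (deg G) (allFin (n G)))

-- Total k-colorings: a vertex colouring and an edge colouring (the edge
-- colouring is a function on ordered pairs, only its values on edges matter,
-- and it must be symmetric on edges).
record TotalColoring (G : Graph) (k : ℕ) : Set where
  field
    vcol : Fin (n G) → Fin k
    ecol : Fin (n G) → Fin (n G) → Fin k
    ecol-sym : ∀ u v → adj G u v ≡ true → ecol u v ≡ ecol v u
    vv : ∀ u v → adj G u v ≡ true → vcol u ≢ vcol v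
    ee : ∀ u v w → adj G u v ≡ true → adj G u w ≡ true → v ≢ w →
         ecol u v ≢ ecol u w
    ve : ∀ u v → adj G u v ≡ true → ecol u v ≢ vcol u

open TotalColoring public

InColorSet : {G : Graph} {k : ℕ} → TotalColoring G k → Fin (n G) → Fin k → Set
InColorSet {G} f v c = (vcol f v ≡ c) ⊎' (∃ λ u → (adj G v u ≡ true) × (ecol f v u ≡ c))
  where
  open import Data.Sum using () renaming (_⊎_ to _⊎'_)

IsAvd : {G : Graph} {k : ℕ} → TotalColoring G k → Set
IsAvd {G} f = ∀ u v → adj G u v ≡ true →
  ¬ (∀ c → InColorSet f u c ⇔ InColorSet f v c)

χ''≤ : Graph → ℕ → Set
χ''≤ G k = Σ ℕ λ k' → (k' ≤ k) × TotalColoring G k'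

χ''a≤ : Graph → ℕ → Set
χ''a≤ G k = Σ ℕ λ k' → (k' ≤ k) × Σ (TotalColoring G k') IsAvd

-- Corona G ∘ H.  Vertices are Fin (n G * suc (n H)); the vertex
-- combine i zero is vertex i of G, combine i (suc j) is vertex j of the
-- copy of H attached to i.
coronaAdj : (G H : Graph) → Fin (n G * suc (n H)) → Fin (n G * suc (n H)) → Bool
coronaAdj G H x y with remQuot {n G} (suc (n H)) x | remQuot {n G} (suc (n H)) y
... | i , zero  | i' , zero   = adj G i i'
... | i , zero  | i' , suc _  = does (i ≟ i')
... | i , suc _ | i' , zero   = does (i ≟ i')
... | i , suc a | i' , suc b  = does (i ≟ i') ∧ adj H a b

corona : Graph → Graph → Graph
corona G H = record { n = n G * suc (n H) ; adj = coronaAdj G H }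

{-# OPTIONS --safe #-}
module Submission where

-- Let K = Δ(G) + t. Color G by an avd total K-coloring f and every copy of H by one total
-- K-coloring g (possible as Δ(H) + t' ≤ K), and give the spoke from the hub i to vertex a of its
-- copy a fresh color new a, one for each vertex of H. Where g(a) = f(i), the copy vertex a is
-- recolored new b for an endpoint b of a fixed edge of H with g(b) ≠ f(i). A hub sees every
-- fresh color, a copy vertex a only new a and its own vertex color: this separates a hub from its
-- copy (using |H| ≥ 2, or f(i) in the recolored case) and two adjacent copy vertices from each
-- other; adjacent hubs are separated by f. As a hub of maximum G-degree has degree
-- Δ(G) + |H| in G ∘ H, the K + |H| colors are at most Δ(G ∘ H) + t.

open import Defs
open import Data.Nat using (ℕ; zero; suc; _+_; _*_; _≤_; z≤n; s≤s)
open import Data.Nat.Properties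
open import Algebra.Properties.CommutativeMonoid.Sum +-0-commutativeMonoid
  using (sum; sum-syntax; ∑-distrib-+; sum-remove; sum-cong-≗)
open import Data.Bool using (Bool; true; false; _∧_)
import Data.Bool as Bool
open import Data.Empty using (⊥; ⊥-elim)
open import Data.Fin as Fin using (Fin; zero; suc; _↑ˡ_; _↑ʳ_; combine; remQuot; inject≤; splitAt)
open import Data.Fin.Properties
  using ( ↑ˡ-injective; ↑ʳ-injective; splitAt-↑ˡ; splitAt-↑ʳ; inject≤-injective
        ; remQuot-combine; combine-remQuot)
open import Data.List using (length; filter; map; tabulate; allFin)
open import Data.List.Properties using (foldr-preservesᵒ)
open import Data.List.Membership.Propositional.Properties
  using (∈-map⁺; ∈-map⁻; ∈-allFin; foldr-selective)
import Data.List.Relation.Unary.Any as Any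
open import Data.Product using (Σ; ∃; ∃₂; _×_; _,_; proj₁; proj₂; uncurry)
open import Data.Sum using (_⊎_; inj₁; inj₂; [_,_])
open import Function using (_∘_)
open import Function.Definitions using (Injective)
open import Function.Bundles using (_⇔_; mk⇔; Equivalence)
open import Function.Construct.Composition using (_⇔-∘_)
open import Function.Construct.Symmetry using (⇔-sym)
open import Relation.Nullary using (¬_; Dec; yes; no; does)
open import Relation.Nullary.Decidable using (dec-true)
open import Relation.Binary.PropositionalEquality using (_≡_; _≢_; refl; sym; trans; cong; cong₂; subst)

fromBool : Bool → ℕ
fromBool true  = 1
fromBool false = 0

length-filter-tabulate : ∀ {A : Set} {m} (ψ : Fin m → A) (q : A → Bool) →
  length (filter (λ x → q x Bool.≟ true) (tabulate ψ)) ≡ ∑[ i < m ] fromBool (q (ψ i))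
length-filter-tabulate {m = zero}  ψ q = refl
length-filter-tabulate {m = suc m} ψ q with q (ψ zero)
... | true  = cong suc (length-filter-tabulate (ψ ∘ suc) q)
... | false = length-filter-tabulate (ψ ∘ suc) q

deg≡sum : (G : Graph) (v : Fin (n G)) → deg G v ≡ ∑[ u < n G ] fromBool (adj G v u)
deg≡sum G v = length-filter-tabulate (λ u → u) (adj G v)

sum-↑ : ∀ m {r} (t : Fin (m + r) → ℕ) →
  sum t ≡ sum (λ i → t (i ↑ˡ r)) + sum (λ j → t (m ↑ʳ j))
sum-↑ zero    t = refl
sum-↑ (suc m) t = trans (cong (t zero +_) (sum-↑ m (t ∘ suc))) (sym (+-assoc (t zero) _ _))

sum-combine : ∀ m {k} (t : Fin (m * k) → ℕ) →
  sum t ≡ ∑[ i < m ] ∑[ j < k ] t (combine i j)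
sum-combine zero        t = refl
sum-combine (suc m) {k} t =
  trans (sum-↑ k t) (cong (sum (λ j → t (j ↑ˡ (m * k))) +_) (sum-combine m (t ∘ (k ↑ʳ_))))

sum-ones : ∀ k → ∑[ j < k ] 1 ≡ k
sum-ones zero    = refl
sum-ones (suc k) = cong suc (sum-ones k)

term≤sum : ∀ {m} (t : Fin m → ℕ) i → t i ≤ sum t
term≤sum {suc _} t i = subst (t i ≤_) (sym (sum-remove {i = i} t)) (m≤m+n (t i) _)

deg≤Δ : (G : Graph) (v : Fin (n G)) → deg G v ≤ Δ G
deg≤Δ G v =
  foldr-preservesᵒ {P = deg G v ≤_} (λ x y → [ m≤n⇒m≤n⊔o y , m≤n⇒m≤o⊔n x ])
    0 (map (deg G) (allFin (n G)))
    (inj₂ (Any.map ≤-reflexive (∈-map⁺ (deg G) (∈-allFin v))))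

Δ-attained : (G : Graph) → Fin (n G) → ∃ λ v → Δ G ≤ deg G v
Δ-attained G v with foldr-selective ⊔-sel 0 (map (deg G) (allFin (n G)))
... | inj₁ Δ≡0 = v , subst (_≤ deg G v) (sym Δ≡0) z≤n
... | inj₂ Δ∈  with ∈-map⁻ (deg G) Δ∈
...   | w , _ , Δ≡deg = w , ≤-reflexive Δ≡deg

-- The corona on pairs (vertex of G, 0 for itself or 1 + vertex of its copy of H)

≟-true⇒≡ : ∀ {m} (i j : Fin m) → does (i Fin.≟ j) ≡ true → i ≡ j
≟-true⇒≡ i j e  with i Fin.≟ j
≟-true⇒≡ i j _  | yes i≡j = i≡j
≟-true⇒≡ i j () | no  _

CoronaVertex : Graph → Graph → Set
CoronaVertex G H = Fin (n G) × Fin (suc (n H))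

coronaAdj× : (G H : Graph) → CoronaVertex G H → CoronaVertex G H → Bool
coronaAdj× G H (i , zero)  (i' , zero)  = adj G i i'
coronaAdj× G H (i , zero)  (i' , suc _) = does (i Fin.≟ i')
coronaAdj× G H (i , suc _) (i' , zero)  = does (i Fin.≟ i')
coronaAdj× G H (i , suc a) (i' , suc b) = does (i Fin.≟ i') ∧ adj H a b

coronaAdj-remQuot : (G H : Graph) → ∀ x y →
  coronaAdj G H x y ≡ coronaAdj× G H (remQuot (suc (n H)) x) (remQuot (suc (n H)) y)
coronaAdj-remQuot G H x y with remQuot {n G} (suc (n H)) x | remQuot {n G} (suc (n H)) y
... | i , zero  | i' , zero  = refl
... | i , zero  | i' , suc _ = refl
... | i , suc _ | i' , zero  = refl
... | i , suc _ | i' , suc _ = refl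

coronaAdj-combine : (G H : Graph) (p q : CoronaVertex G H) →
  coronaAdj G H (uncurry combine p) (uncurry combine q) ≡ coronaAdj× G H p q
coronaAdj-combine G H (i , j) (i' , j') =
  trans (coronaAdj-remQuot G H (combine i j) (combine i' j'))
        (cong₂ (coronaAdj× G H) (remQuot-combine i j) (remQuot-combine i' j'))

deg-hub : (G H : Graph) (v : Fin (n G)) → deg G v + n H ≤ deg (corona G H) (combine v zero)
deg-hub G H v = begin
  deg G v + n H
    ≤⟨ +-monoʳ-≤ (deg G v) n≤spokes ⟩
  deg G v + ∑[ i < n G ] spokes i
    ≡⟨ cong (_+ ∑[ i < n G ] spokes i) (deg≡sum G v) ⟩
  ∑[ i < n G ] fromBool (adj G v i) + ∑[ i < n G ] spokes i
    ≡⟨ ∑-distrib-+ (fromBool ∘ adj G v) spokes ⟨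
  ∑[ i < n G ] ∑[ j < suc (n H) ] fromBool (coronaAdj× G H (v , zero) (i , j))
    ≡⟨ sum-cong-≗ (λ i → sum-cong-≗ (λ j →
         cong fromBool (coronaAdj-combine G H (v , zero) (i , j)))) ⟨
  ∑[ i < n G ] ∑[ j < suc (n H) ] fromBool (coronaAdj G H (combine v zero) (combine i j))
    ≡⟨ sum-combine (n G) (fromBool ∘ coronaAdj G H (combine v zero)) ⟨
  ∑[ x < n G * suc (n H) ] fromBool (coronaAdj G H (combine v zero) x)
    ≡⟨ deg≡sum (corona G H) (combine v zero) ⟨
  deg (corona G H) (combine v zero) ∎
  where
  open ≤-Reasoning
  spokes : Fin (n G) → ℕ
  spokes i = ∑[ j < n H ] fromBool (does (v Fin.≟ i))
  n≤spokes : n H ≤ ∑[ i < n G ] spokes i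
  n≤spokes = begin
    n H                    ≡⟨ sum-ones (n H) ⟨
    ∑[ j < n H ] 1         ≡⟨ cong (λ b → ∑[ j < n H ] fromBool b) (dec-true (v Fin.≟ v) refl) ⟨
    spokes v               ≤⟨ term≤sum spokes v ⟩
    ∑[ i < n G ] spokes i  ∎

Δ-corona : (G H : Graph) → Fin (n G) → Δ G + n H ≤ Δ (corona G H)
Δ-corona G H v₀ with Δ-attained G v₀
... | v , Δ≤deg = begin
  Δ G + n H                         ≤⟨ +-monoˡ-≤ (n H) Δ≤deg ⟩
  deg G v + n H                     ≤⟨ deg-hub G H v ⟩
  deg (corona G H) (combine v zero) ≤⟨ deg≤Δ (corona G H) (combine v zero) ⟩
  Δ (corona G H)                    ∎
  where open ≤-Reasoning

module _ {G : Graph} {k k' : ℕ} (σ : Fin k → Fin k') (σ-injective : Injective _≡_ _≡_ σ) where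

  recolor : TotalColoring G k → TotalColoring G k'
  recolor f = record
    { vcol     = σ ∘ vcol f
    ; ecol     = λ u v → σ (ecol f u v)
    ; ecol-sym = λ u v e → cong σ (ecol-sym f u v e)
    ; vv       = λ u v e → vv f u v e ∘ σ-injective
    ; ee       = λ u v w e e' v≢w → ee f u v w e e' v≢w ∘ σ-injective
    ; ve       = λ u v e → ve f u v e ∘ σ-injective
    }

  inColorSet-recolor : (f : TotalColoring G k) → ∀ v c →
    InColorSet (recolor f) v (σ c) ⇔ InColorSet f v c
  inColorSet-recolor f v c = mk⇔
    (λ { (inj₁ e) → inj₁ (σ-injective e) ; (inj₂ (u , uv , e)) → inj₂ (u , uv , σ-injective e) })
    (λ { (inj₁ e) → inj₁ (cong σ e)      ; (inj₂ (u , uv , e)) → inj₂ (u , uv , cong σ e) })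

  recolor-avd : (f : TotalColoring G k) → IsAvd f → IsAvd (recolor f)
  recolor-avd f f-avd u v uv same = f-avd u v uv λ c →
    inColorSet-recolor f v c ⇔-∘ (same (σ c) ⇔-∘ ⇔-sym (inColorSet-recolor f u c))

χ''≤-mono : ∀ {G k k'} → k ≤ k' → χ''≤ G k → χ''≤ G k'
χ''≤-mono k≤k' (j , j≤k , f) = j , ≤-trans j≤k k≤k' , f

χ''a≤-mono : ∀ {G k k'} → k ≤ k' → χ''a≤ G k → χ''a≤ G k'
χ''a≤-mono k≤k' (j , j≤k , f) = j , ≤-trans j≤k k≤k' , f

χ''≤-coloring : ∀ {G k} → χ''≤ G k → TotalColoring G k
χ''≤-coloring (j , j≤k , f) = recolor (λ c → inject≤ c j≤k) (inject≤-injective j≤k j≤k _ _) f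

χ''a≤-coloring : ∀ {G k} → χ''a≤ G k → Σ (TotalColoring G k) IsAvd
χ''a≤-coloring (j , j≤k , f , f-avd) =
  recolor σ σ-injective f , recolor-avd σ σ-injective f f-avd
  where
  σ : Fin j → Fin _
  σ c = inject≤ c j≤k
  σ-injective : Injective _≡_ _≡_ σ
  σ-injective = inject≤-injective j≤k j≤k _ _

two-distinct : ∀ {m} → 2 ≤ m → ∃₂ λ (a b : Fin m) → a ≢ b
two-distinct {suc zero}    (s≤s ())
two-distinct {suc (suc _)} _ = zero , suc zero , λ ()

reachable⇒first-edge : ∀ {G u v} → u ≢ v → Reachable G u v → ∃ λ w → adj G u w ≡ true
reachable⇒first-edge u≢v here       = ⊥-elim (u≢v refl)
reachable⇒first-edge _   (step e _) = _ , e

connected⇒edge : (G : Graph) → Connected G → 2 ≤ n G → ∃₂ λ a b → adj G a b ≡ true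
connected⇒edge G conn 2≤n with two-distinct 2≤n
... | a , b , a≢b = a , reachable⇒first-edge a≢b (conn a b)

-- An avd total coloring of the corona

module CoronaColoring {G H : Graph} {K : ℕ}
  (f : TotalColoring G K) (f-avd : IsAvd f) (g : TotalColoring H K)
  {a₀ b₀ : Fin (n H)} (a₀b₀ : adj H a₀ b₀ ≡ true) where

  N : ℕ
  N = n H

  old : Fin K → Fin (K + N)
  old c = c ↑ˡ N

  new : Fin N → Fin (K + N)
  new a = K ↑ʳ a

  old-injective : ∀ {c d} → old c ≡ old d → c ≡ d
  old-injective = ↑ˡ-injective N _ _

  new-injective : ∀ {a b} → new a ≡ new b → a ≡ b
  new-injective = ↑ʳ-injective K _ _

  old≢new : ∀ {c a} → old c ≢ new a
  old≢new {c} {a} e with trans (sym (splitAt-↑ˡ K c N)) (trans (cong (splitAt K) e) (splitAt-↑ʳ K N a))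
  ... | ()

  adj⇒≢ : ∀ {a b} → adj H a b ≡ true → a ≢ b
  adj⇒≢ ab a≡b = vv g _ _ ab (cong (vcol g) a≡b)

  partner : Fin N → Fin N
  partner a with a Fin.≟ a₀
  ... | yes _ = b₀
  ... | no  _ = a₀

  partner-≢ : ∀ a → partner a ≢ a
  partner-≢ a with a Fin.≟ a₀
  ... | yes a≡a₀ = λ b₀≡a → adj⇒≢ a₀b₀ (trans (sym a≡a₀) (sym b₀≡a))
  ... | no  a≢a₀ = λ a₀≡a → a≢a₀ (sym a₀≡a)

  avoiding : Fin K → Fin N
  avoiding c with vcol g a₀ Fin.≟ c
  ... | yes _ = b₀
  ... | no  _ = a₀

  avoiding-≢ : ∀ c → vcol g (avoiding c) ≢ c
  avoiding-≢ c with vcol g a₀ Fin.≟ c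
  ... | yes a₀↦c = λ b₀↦c → vv g a₀ b₀ a₀b₀ (trans a₀↦c (sym b₀↦c))
  ... | no  a₀↛c = a₀↛c

  copyColor : Fin (n G) → Fin N → Fin (K + N)
  copyColor i a with vcol g a Fin.≟ vcol f i
  ... | yes _ = new (avoiding (vcol f i))
  ... | no  _ = old (vcol g a)

  data CopyColor (i : Fin (n G)) (a : Fin N) : Fin (K + N) → Set where
    recolored : vcol g a ≡ vcol f i → CopyColor i a (new (avoiding (vcol f i)))
    kept      : vcol g a ≢ vcol f i → CopyColor i a (old (vcol g a))

  copyColor-view : ∀ i a → CopyColor i a (copyColor i a)
  copyColor-view i a with vcol g a Fin.≟ vcol f i
  ... | yes clash = recolored clash
  ... | no  fine  = kept fine

  Vertex : Set
  Vertex = CoronaVertex G H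

  _~_ : Vertex → Vertex → Set
  p ~ q = coronaAdj× G H p q ≡ true

  copy~copy⇒ : ∀ i i' {a b} → (i , suc a) ~ (i' , suc b) → i ≡ i' × adj H a b ≡ true
  copy~copy⇒ i i' e  with i Fin.≟ i'
  copy~copy⇒ i i' ab | yes i≡i' = i≡i' , ab
  copy~copy⇒ i i' () | no  _

  vertexColor : Vertex → Fin (K + N)
  vertexColor (i , zero)  = old (vcol f i)
  vertexColor (i , suc a) = copyColor i a

  edgeColor : Vertex → Vertex → Fin (K + N)
  edgeColor (i , zero)  (i' , zero)  = old (ecol f i i')
  edgeColor (_ , zero)  (_ , suc a)  = new a
  edgeColor (_ , suc a) (_ , zero)   = new a
  edgeColor (_ , suc a) (_ , suc b)  = old (ecol g a b)

  edgeColor-sym : ∀ p q → p ~ q → edgeColor p q ≡ edgeColor q p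
  edgeColor-sym (i , zero)  (i' , zero)  e = cong old (ecol-sym f i i' e)
  edgeColor-sym (_ , zero)  (_ , suc _)  _ = refl
  edgeColor-sym (_ , suc _) (_ , zero)   _ = refl
  edgeColor-sym (i , suc a) (i' , suc b) e = cong old (ecol-sym g a b (proj₂ (copy~copy⇒ i i' e)))

  hub≢copy : ∀ i a → old (vcol f i) ≢ copyColor i a
  hub≢copy i a with copyColor i a | copyColor-view i a
  ... | _ | recolored _ = old≢new
  ... | _ | kept fine    = fine ∘ sym ∘ old-injective

  copy≢copy : ∀ i {a b} → adj H a b ≡ true → copyColor i a ≢ copyColor i b
  copy≢copy i {a} {b} ab with copyColor i a | copyColor-view i a | copyColor i b | copyColor-view i b
  ... | _ | recolored a↦fi | _ | recolored b↦fi = λ _ → vv g a b ab (trans a↦fi (sym b↦fi))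
  ... | _ | recolored _    | _ | kept _          = old≢new ∘ sym
  ... | _ | kept _          | _ | recolored _    = old≢new
  ... | _ | kept _          | _ | kept _          = vv g a b ab ∘ old-injective

  vertexColor-proper : ∀ p q → p ~ q → vertexColor p ≢ vertexColor q
  vertexColor-proper (i , zero)  (i' , zero)  e = vv f i i' e ∘ old-injective
  vertexColor-proper (i , zero)  (i' , suc a) e with refl ← ≟-true⇒≡ i i' e = hub≢copy i a
  vertexColor-proper (i , suc a) (i' , zero)  e with refl ← ≟-true⇒≡ i i' e = hub≢copy i a ∘ sym
  vertexColor-proper (i , suc a) (i' , suc b) e with copy~copy⇒ i i' e
  ... | refl , ab = copy≢copy i ab

  edgeColor-proper : ∀ p q r → p ~ q → p ~ r → q ≢ r → edgeColor p q ≢ edgeColor p r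
  edgeColor-proper (i , zero) (i₁ , zero) (i₂ , zero) e₁ e₂ q≢r =
    ee f i i₁ i₂ e₁ e₂ (q≢r ∘ cong (_, zero)) ∘ old-injective
  edgeColor-proper (_ , zero) (_ , zero)  (_ , suc _) _ _ _ = old≢new
  edgeColor-proper (_ , zero) (_ , suc _) (_ , zero)  _ _ _ = old≢new ∘ sym
  edgeColor-proper (i , zero) (i₁ , suc a) (i₂ , suc b) e₁ e₂ q≢r
    with refl ← ≟-true⇒≡ i i₁ e₁ | refl ← ≟-true⇒≡ i i₂ e₂ =
      q≢r ∘ cong (λ c → (_ , suc c)) ∘ new-injective
  edgeColor-proper (i , suc _) (i₁ , zero) (i₂ , zero) e₁ e₂ q≢r
    with refl ← ≟-true⇒≡ i i₁ e₁ | refl ← ≟-true⇒≡ i i₂ e₂ = λ _ → q≢r refl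
  edgeColor-proper (_ , suc _) (_ , zero)  (_ , suc _) _ _ _ = old≢new ∘ sym
  edgeColor-proper (_ , suc _) (_ , suc _) (_ , zero)  _ _ _ = old≢new
  edgeColor-proper (i , suc a) (i₁ , suc b) (i₂ , suc c) e₁ e₂ q≢r
    with copy~copy⇒ i i₁ e₁ | copy~copy⇒ i i₂ e₂
  ... | refl , ab | refl , ac = ee g a b c ab ac (q≢r ∘ cong (λ d → (_ , suc d))) ∘ old-injective

  edgeColor≢vertexColor : ∀ p q → p ~ q → edgeColor p q ≢ vertexColor p
  edgeColor≢vertexColor (i , zero)  (i' , zero) e = ve f i i' e ∘ old-injective
  edgeColor≢vertexColor (_ , zero)  (_ , suc _) _ = old≢new ∘ sym
  edgeColor≢vertexColor (i , suc a) (_ , zero)  _ with copyColor i a | copyColor-view i a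
  ... | _ | recolored a↦fi =
    λ e → avoiding-≢ (vcol f i) (subst (λ b → vcol g b ≡ vcol f i) (new-injective e) a↦fi)
  ... | _ | kept _          = old≢new ∘ sym
  edgeColor≢vertexColor (i , suc a) (i' , suc b) e with copyColor i a | copyColor-view i a
  ... | _ | recolored _ = old≢new
  ... | _ | kept _       = ve g a b (proj₂ (copy~copy⇒ i i' e)) ∘ old-injective

  InColorSet× : Vertex → Fin (K + N) → Set
  InColorSet× p c = (vertexColor p ≡ c) ⊎ ∃ λ q → p ~ q × edgeColor p q ≡ c

  hubColorSet⇔ : ∀ i c → InColorSet× (i , zero) (old c) ⇔ InColorSet f i c
  hubColorSet⇔ i c = mk⇔
    (λ { (inj₁ e) → inj₁ (old-injective e)
       ; (inj₂ ((u , zero) , iu , e)) → inj₂ (u , iu , old-injective e)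
       ; (inj₂ ((_ , suc _) , _ , e)) → ⊥-elim (old≢new (sym e)) })
    (λ { (inj₁ e) → inj₁ (cong old e)
       ; (inj₂ (u , iu , e)) → inj₂ ((u , zero) , iu , cong old e) })

  hub~copy : ∀ i a → (i , zero) ~ (i , suc a)
  hub~copy i _ = dec-true (i Fin.≟ i) refl

  newColorAtCopy : ∀ i a c → InColorSet× (i , suc a) (new c) →
    c ≡ a ⊎ (vcol g a ≡ vcol f i × c ≡ avoiding (vcol f i))
  newColorAtCopy i a c (inj₁ e) with copyColor i a | copyColor-view i a
  ... | _ | recolored a↦fi = inj₂ (a↦fi , sym (new-injective e))
  ... | _ | kept _          = ⊥-elim (old≢new e)
  newColorAtCopy i a c (inj₂ ((_ , zero) , _ , e))  = inj₁ (sym (new-injective e))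
  newColorAtCopy i a c (inj₂ ((_ , suc _) , _ , e)) = ⊥-elim (old≢new e)

  hubColorNotAtCopy : ∀ i a → vcol g a ≡ vcol f i → ¬ InColorSet× (i , suc a) (old (vcol f i))
  hubColorNotAtCopy i a _    (inj₁ e)                      = hub≢copy i a (sym e)
  hubColorNotAtCopy i a _    (inj₂ ((_ , zero) , _ , e))   = old≢new (sym e)
  hubColorNotAtCopy i a a↦fi (inj₂ ((i' , suc b) , e , ab↦fi)) =
    ve g a b (proj₂ (copy~copy⇒ i i' e)) (trans (old-injective ab↦fi) (sym a↦fi))

  hub≁copy : ∀ i a → ¬ (∀ c → InColorSet× (i , zero) c ⇔ InColorSet× (i , suc a) c)
  hub≁copy i a same = distinguish (vcol g a Fin.≟ vcol f i)
    where
    distinguish : Dec (vcol g a ≡ vcol f i) → ⊥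
    distinguish (yes a↦fi) =
      hubColorNotAtCopy i a a↦fi (Equivalence.to (same (old (vcol f i))) (inj₁ refl))
    distinguish (no a↛fi) =
      [ partner-≢ a , a↛fi ∘ proj₁ ] (newColorAtCopy i a (partner a) (Equivalence.to (same (new (partner a)))
        (inj₂ ((i , suc (partner a)) , hub~copy i (partner a) , refl))))

  copy≁copy : ∀ i {a b} → adj H a b ≡ true →
    ¬ (∀ c → InColorSet× (i , suc a) c ⇔ InColorSet× (i , suc b) c)
  copy≁copy i {a} {b} ab same
    with newColorAtCopy i a b (Equivalence.from (same _) (inj₂ ((i , zero) , hub~copy i b , refl)))
       | newColorAtCopy i b a (Equivalence.to   (same _) (inj₂ ((i , zero) , hub~copy i a , refl)))
  ... | inj₁ b≡a       | _              = adj⇒≢ ab (sym b≡a)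
  ... | _              | inj₁ a≡b       = adj⇒≢ ab a≡b
  ... | inj₂ (_ , b≡z) | inj₂ (_ , a≡z) = adj⇒≢ ab (trans a≡z (sym b≡z))

  avd× : ∀ p q → p ~ q → ¬ (∀ c → InColorSet× p c ⇔ InColorSet× q c)
  avd× (i , zero)  (i' , zero) e same =
    f-avd i i' e λ c → hubColorSet⇔ i' c ⇔-∘ (same (old c) ⇔-∘ ⇔-sym (hubColorSet⇔ i c))
  avd× (i , zero)  (i' , suc a) e same with refl ← ≟-true⇒≡ i i' e = hub≁copy i a same
  avd× (i , suc a) (i' , zero)  e same with refl ← ≟-true⇒≡ i i' e = hub≁copy i a (⇔-sym ∘ same)
  avd× (i , suc a) (i' , suc b) e same with copy~copy⇒ i i' e
  ... | refl , ab = copy≁copy i ab same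

  split : Fin (n (corona G H)) → Vertex
  split = remQuot (suc N)

  split-injective : ∀ {x y} → split x ≡ split y → x ≡ y
  split-injective {x} {y} e =
    trans (sym (combine-remQuot {n G} (suc N) x))
          (trans (cong (uncurry combine) e) (combine-remQuot {n G} (suc N) y))

  split-combine : ∀ q → split (uncurry combine q) ≡ q
  split-combine (i , j) = remQuot-combine i j

  adj⇒~ : ∀ {x y} → adj (corona G H) x y ≡ true → split x ~ split y
  adj⇒~ {x} {y} e = trans (sym (coronaAdj-remQuot G H x y)) e

  coloring : TotalColoring (corona G H) (K + N)
  coloring = record
    { vcol     = vertexColor ∘ split
    ; ecol     = λ x y → edgeColor (split x) (split y)
    ; ecol-sym = λ x y e → edgeColor-sym (split x) (split y) (adj⇒~ e)
    ; vv       = λ x y e → vertexColor-proper (split x) (split y) (adj⇒~ e)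
    ; ee       = λ x y z e e' y≢z →
                   edgeColor-proper (split x) (split y) (split z)
                     (adj⇒~ e) (adj⇒~ e') (y≢z ∘ split-injective)
    ; ve       = λ x y e → edgeColor≢vertexColor (split x) (split y) (adj⇒~ e)
    }

  inColorSet⇔InColorSet× : ∀ x c → InColorSet coloring x c ⇔ InColorSet× (split x) c
  inColorSet⇔InColorSet× x c = mk⇔
    (λ { (inj₁ e) → inj₁ e ; (inj₂ (y , xy , e)) → inj₂ (split y , adj⇒~ xy , e) })
    (λ { (inj₁ e) → inj₁ e
       ; (inj₂ (q , xq , e)) → inj₂ (uncurry combine q
           , trans (coronaAdj-remQuot G H x _) (subst (split x ~_) (sym (split-combine q)) xq)
           , subst (λ r → edgeColor (split x) r ≡ c) (sym (split-combine q)) e) })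

  coloring-avd : IsAvd coloring
  coloring-avd x y e same =
    avd× (split x) (split y) (adj⇒~ e) λ c →
      inColorSet⇔InColorSet× y c ⇔-∘ (same c ⇔-∘ ⇔-sym (inColorSet⇔InColorSet× x c))

χ''a≤-corona : (G H : Graph) (K : ℕ) → χ''a≤ G K → χ''≤ H K →
  (∃₂ λ a b → adj H a b ≡ true) → χ''a≤ (corona G H) (K + n H)
χ''a≤-corona G H K χG χH (_ , _ , ab) with χ''a≤-coloring χG
... | f , f-avd = K + n H , ≤-refl , coloring , coloring-avd
  where open CoronaColoring f f-avd (χ''≤-coloring χH) ab

corollary1 : (G H : Graph) (t t' : ℕ) →
    IsSimple G → IsSimple H → Connected G → Connected H →
    2 ≤ n G → 2 ≤ n H →
    2 ≤ t → 1 ≤ t' → t' ≤ t →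
    χ''a≤ G (Δ G + t) → χ''≤ H (Δ H + t') →
    Δ H ≤ Δ G →
    χ''a≤ (corona G H) (Δ (corona G H) + t)
corollary1 G H t t' _ _ _ H-conn 2≤nG 2≤nH _ _ t'≤t χG χH ΔH≤ΔG =
  χ''a≤-mono colors≤ (χ''a≤-corona G H (Δ G + t) χG χH′ (connected⇒edge H H-conn 2≤nH))
  where
  χH′ : χ''≤ H (Δ G + t)
  χH′ = χ''≤-mono (+-mono-≤ ΔH≤ΔG t'≤t) χH
  open ≤-Reasoning
  colors≤ : Δ G + t + n H ≤ Δ (corona G H) + t
  colors≤ = begin
    Δ G + t + n H           ≡⟨ +-assoc (Δ G) t (n H) ⟩
    Δ G + (t + n H)         ≡⟨ cong (Δ G +_) (+-comm t (n H)) ⟩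
    Δ G + (n H + t)         ≡⟨ +-assoc (Δ G) (n H) t ⟨
    Δ G + n H + t           ≤⟨ +-monoˡ-≤ t (Δ-corona G H (proj₁ (two-distinct 2≤nG))) ⟩
    Δ (corona G H) + t      ∎
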